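{- Let $H=(U,(A_1,\dots,A_m))$ be a harmonic set system with $|U|<m(m-2)$ and $m\ge 51$. Then for any two nonconsecutive sets $I,J\subseteq[m]$ with $|I|=|J|=3$, we have $\bigcap_{i\in I}A_i\cap\bigcap_{j\in J}(U\setminus A_j)=\varnothing$.
   Context: A set of integers is nonconsecutive if no two distinct elements differ by exactly $1$. A set system is $H=(U,(A_1,\dots,A_m))$ with $A_i\subseteq U$. For $I\subseteq[m]$, $H_I=\bigcap_{i\in I}A_i$ ($=U$ if $I=\varnothing$). The run decomposition of a finite set $I$ of positive integers is the partition formed by the sizes, sorted nonincreasingly, of the maximal runs of consecutive integers in $I$. $H$ is harmonic if $|H_I|=|H_J|$ whenever $I,J\subseteq[m]$ have the same run decomposition. -}

module Defs where

open import Data.Nat using (ℕ; zero; suc)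
open import Data.Bool using (Bool; true; false; not; _∨_)
open import Data.List using (List; []; _∷_)
open import Data.Bool using (_∧_)
open import Data.List.Relation.Binary.Permutation.Propositional using (_↭_)
open import Data.Vec using (Vec; tabulate; toList; lookup)
open import Data.Fin using (Fin; toℕ)
open import Data.Fin.Subset using (Subset; _∈_; _∉_; ∣_∣)
open import Data.List using (allFin)
open import Relation.Binary.PropositionalEquality using (_≡_; _≢_)

-- A set system on the ground set U = Fin n with m sets A_i (i ∈ Fin m,
-- index i standing for i+1 ∈ [m]).
SetSystem : ℕ → ℕ → Set
SetSystem n m = Fin m → Subset n

allB : ∀ {a} {X : Set a} → (X → Bool) → List X → Bool
allB p []       = true
allB p (x ∷ xs) = p x ∧ allB p xs

H_ : ∀ {n m} → SetSystem n m → Subset m → Subset n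
H_ {n} {m} A I = tabulate λ u → allB (λ i → not (lookup I i) ∨ lookup (A i) u) (allFin m)

-- Lengths of the maximal runs of consecutive elements, scanning left to right.
-- k = length of the run currently being read.
runsAux : ℕ → List Bool → List ℕ
runsAux zero    []            = []
runsAux (suc k) []            = suc k ∷ []
runsAux k       (true  ∷ bs)  = runsAux (suc k) bs
runsAux zero    (false ∷ bs)  = runsAux zero bs
runsAux (suc k) (false ∷ bs)  = suc k ∷ runsAux zero bs

runs : ∀ {m} → Subset m → List ℕ
runs I = runsAux zero (toList I)

-- Same run decomposition: the multisets of run lengths coincide
-- (equivalently, the nonincreasingly sorted lists coincide).
SameRunDecomposition : ∀ {m} → Subset m → Subset m → Set
SameRunDecomposition I J = runs I ↭ runs J

Harmonic : ∀ {n m} → SetSystem n m → Set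
Harmonic {n} {m} A = ∀ (I J : Subset m) → SameRunDecomposition I J → ∣ H_ A I ∣ ≡ ∣ H_ A J ∣

Nonconsecutive : ∀ {m} → Subset m → Set
Nonconsecutive {m} I = ∀ (i j : Fin m) → i ∈ I → j ∈ I → toℕ j ≢ suc (toℕ i)

-- Call a list of positions spread if any two of its entries differ by at least 2, and call a
-- pair of lists (Ys, Ns) a pattern, matched by the points lying in every A_i with i ∈ Ys and in
-- no A_j with j ∈ Ns. For a spread pattern the number #(Ys, Ns) of matching points depends only
-- on |Ys| and |Ns|: for Ns = [] this is harmonicity, since a nonconsecutive set of size k has run
-- decomposition 1^k, and a negative constraint z is removed by inclusion–exclusion,
-- #(Ys, z ∷ Ns) = #(Ys, Ns) − #(z ∷ Ys, Ns).
--
-- Suppose u lies in A_i for i ∈ I and outside A_j for j ∈ J. Each point of I ∪ J is within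
-- distance 1 of at most two even positions, so many even positions are far from I ∪ J, and three
-- of them can replace I or J to give a spread (3,3)-pattern matched by u. Hence every spread
-- (3,3)-pattern is matched, and some point u₁ lies in at least three and outside at least three
-- of the sets A_d with d even. If u₁ lies in a and outside b of them, each of the C(a+b, a)
-- patterns on the even positions with a positive and b negative constraints has the same count
-- as u₁'s own pattern, so is matched; distinct such patterns are matched by disjoint sets of
-- points. Thus |U| ≥ C(a+b, a) ≥ m(m − 2), since a, b ≥ 3 and 2(a + b) ≥ m ≥ 51.
module Submission where

open import Defs
open import Data.Bool using (Bool; true; false; not; _∧_; _∨_)
import Data.Bool as Bool
open import Data.Bool.Properties using (∧-assoc; ∧-comm; ∧-identityʳ; not-injective; ¬-not; ⇔→≡)
open import Data.Fin using (Fin; zero; suc; toℕ)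
import Data.Fin as Fin
open import Data.Fin.Properties using (_≟_)
open import Data.Fin.Subset using (Subset; _∈_; _∉_; ∣_∣; ⊥; ⁅_⁆; _∪_)
open import Data.Fin.Subset.Properties using (∣p∣≤n; ∣⊥∣≡0; ∉⊥; x∈⁅x⁆; x∈⁅y⁆⇒x≡y; x∈p∪q⁺; x∈p∪q⁻; ∪-identityˡ)
open import Data.List using (List; []; _∷_; _++_; length; foldr; replicate; allFin; map; filter; take; drop)
open import Data.List.Membership.Propositional using () renaming (_∈_ to _∈ₗ_)
open import Data.List.Membership.Propositional.Properties using (∈-allFin)
open import Data.List.Properties
  using (++-identityʳ; length-map; length-++; length-take; length-drop; filter-all; filter-accept; filter-reject; take++drop≡id)
open import Data.List.Relation.Binary.Permutation.Propositional using (_↭_; prep; ↭-refl; ↭-sym; ↭-trans; ↭-reflexive; ↭⇒↭ₛ)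
open import Data.List.Relation.Binary.Permutation.Propositional.Properties using (shift; ++⁺ˡ; ↭-length)
import Data.List.Relation.Binary.Permutation.Setoid.Properties as Permutationₛ
open import Data.List.Relation.Binary.Sublist.Propositional using (_⊆_; []; _∷_; _∷ʳ_; ⊆-refl; ⊆-trans)
import Data.List.Relation.Binary.Sublist.Propositional.Properties as Sublist
open import Data.List.Relation.Unary.All as All using (All; []; _∷_)
import Data.List.Relation.Unary.All.Properties as All
open import Data.List.Relation.Unary.AllPairs as AllPairs using (AllPairs; []; _∷_)
import Data.List.Relation.Unary.AllPairs.Properties as AllPairs
open import Data.List.Relation.Unary.Any using (here; there)
open import Data.Nat using (ℕ; zero; suc; _+_; _*_; _∸_; _≤_; _<_; _≥_; z≤n; s≤s)
open import Data.Nat.Properties hiding (_≟_)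
open import Data.Nat.Tactic.RingSolver using (solve-∀)
open import Data.Product using (_×_; _,_; proj₁; proj₂; ∃; ∃₂)
open import Data.Sum as Sum using (_⊎_; inj₁; inj₂)
open import Data.Vec using ([]; _∷_; lookup; tabulate; here; there)
open import Data.Vec.Properties using (tabulate-cong; lookup∘tabulate; []=⇒lookup; lookup⇒[]=)
open import Function using (_∘_; id; _⇔_; mk⇔; Equivalence)
open import Relation.Binary using (Rel; Symmetric; Decidable; _Respects_)
open import Relation.Binary.PropositionalEquality
open import Relation.Nullary using (¬_; contradiction; Dec; yes; no)
open import Relation.Nullary.Decidable using (_⊎-dec_)
import Relation.Unary as U

private
  variable
    n m : ℕ

count : (Fin n → Bool) → ℕ
count f = ∣ tabulate f ∣

count-cong : {f g : Fin n → Bool} → (∀ i → f i ≡ g i) → count f ≡ count g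
count-cong f≗g = cong ∣_∣ (tabulate-cong f≗g)

count≤n : (f : Fin n → Bool) → count f ≤ n
count≤n f = ∣p∣≤n (tabulate f)

count-split : (g f : Fin n → Bool) → count f ≡ count (λ i → g i ∧ f i) + count (λ i → not (g i) ∧ f i)
count-split {zero}  g f = refl
count-split {suc n} g f with g zero | f zero | count-split (g ∘ suc) (f ∘ suc)
... | true  | true  | ih = cong suc ih
... | true  | false | ih = ih
... | false | true  | ih = trans (cong suc ih) (sym (+-suc _ _))
... | false | false | ih = ih

0<count : (f : Fin n → Bool) {i : Fin n} → f i ≡ true → 0 < count f
0<count {suc n} f {zero}  fi≡true with f zero
... | true  = s≤s z≤n
0<count {suc n} f {suc i} fi≡true with f zero
... | true  = s≤s z≤n
... | false = 0<count (f ∘ suc) fi≡true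

0<count⇒∃ : (f : Fin n → Bool) → 0 < count f → ∃ λ i → f i ≡ true
0<count⇒∃ {suc n} f 0<cnt with f zero in f0≡true
... | true  = zero , f0≡true
... | false = let i , fi≡true = 0<count⇒∃ (f ∘ suc) 0<cnt in suc i , fi≡true

allB⁺ : ∀ {X : Set} {p : X → Bool} {xs} → All (λ x → p x ≡ true) xs → allB p xs ≡ true
allB⁺ []                    = refl
allB⁺ (px ∷ pxs) rewrite px = allB⁺ pxs

allB⁻ : ∀ {X : Set} (p : X → Bool) xs → allB p xs ≡ true → All (λ x → p x ≡ true) xs
allB⁻ p []       _ = []
allB⁻ p (x ∷ xs) h with p x in px
... | true = px ∷ allB⁻ p xs h

-- Intersections over nonconsecutive sets

∈H⇔ : (A : SetSystem n m) (I : Subset m) {u : Fin n} → u ∈ H_ A I ⇔ (∀ {i} → i ∈ I → u ∈ A i)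
∈H⇔ {n} {m} A I {u} = mk⇔ to from
  where
    entry : Fin m → Bool
    entry i = not (lookup I i) ∨ lookup (A i) u

    H≡ : lookup (H_ A I) u ≡ allB entry (allFin m)
    H≡ = lookup∘tabulate _ u

    to : u ∈ H_ A I → ∀ {i} → i ∈ I → u ∈ A i
    to u∈H {i} i∈I = lookup⇒[]= u (A i)
      (subst (λ b → not b ∨ lookup (A i) u ≡ true) ([]=⇒lookup i∈I) (All.lookup entries (∈-allFin i)))
      where entries = allB⁻ entry (allFin m) (trans (sym H≡) ([]=⇒lookup u∈H))

    from : (∀ {i} → i ∈ I → u ∈ A i) → u ∈ H_ A I
    from I⊆A = lookup⇒[]= u (H_ A I) (trans H≡ (allB⁺ (All.tabulate⁺ entry≡true)))
      where
        entry≡true : ∀ i → entry i ≡ true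
        entry≡true i with lookup I i in Ii
        ... | false = refl
        ... | true  = []=⇒lookup (I⊆A (lookup⇒[]= i I Ii))

Nonconsecutive-tail : ∀ {b} {I : Subset m} → Nonconsecutive (b ∷ I) → Nonconsecutive I
Nonconsecutive-tail nc i j i∈I j∈I = nc (suc i) (suc j) (there i∈I) (there j∈I) ∘ cong suc

runs-nonconsecutive : (I : Subset m) → Nonconsecutive I → runs I ≡ replicate ∣ I ∣ 1
runs-nonconsecutive []                 _  = refl
runs-nonconsecutive (false ∷ I)        nc = runs-nonconsecutive I (Nonconsecutive-tail nc)
runs-nonconsecutive (true ∷ [])        _  = refl
runs-nonconsecutive (true ∷ true ∷ I)  nc = contradiction refl (nc zero (suc zero) here (there here))
runs-nonconsecutive (true ∷ false ∷ I) nc =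
  cong (1 ∷_) (runs-nonconsecutive I (Nonconsecutive-tail (Nonconsecutive-tail nc)))

harmonic-nonconsecutive : (A : SetSystem n m) → Harmonic A → {I J : Subset m} →
                          Nonconsecutive I → Nonconsecutive J → ∣ I ∣ ≡ ∣ J ∣ → ∣ H_ A I ∣ ≡ ∣ H_ A J ∣
harmonic-nonconsecutive A harmonic {I} {J} ncI ncJ ∣I∣≡∣J∣ = harmonic I J (↭-reflexive (begin
  runs I                ≡⟨ runs-nonconsecutive I ncI ⟩
  replicate (∣ I ∣) 1   ≡⟨ cong (λ k → replicate k 1) ∣I∣≡∣J∣ ⟩
  replicate (∣ J ∣) 1   ≡⟨ runs-nonconsecutive J ncJ ⟨
  runs J                ∎))
  where open ≡-Reasoning

-- Spread lists of positions

Far : Rel (Fin m) _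
Far i j = 2 + toℕ i ≤ toℕ j ⊎ 2 + toℕ j ≤ toℕ i

Far? : Decidable (Far {m})
Far? i j = (2 + toℕ i ≤? toℕ j) ⊎-dec (2 + toℕ j ≤? toℕ i)

Far-sym : Symmetric (Far {m})
Far-sym = Sum.swap

Far-irrefl : {i : Fin m} → ¬ Far i i
Far-irrefl (inj₁ i≪i) = 1+n≰n (≤-trans (n≤1+n _) i≪i)
Far-irrefl (inj₂ i≪i) = 1+n≰n (≤-trans (n≤1+n _) i≪i)

Far-suc : {i j : Fin m} → Far i j → Far (suc i) (suc j)
Far-suc = Sum.map s≤s s≤s

Far⇒nonadjacent : {i j : Fin m} → Far i j → toℕ j ≢ suc (toℕ i)
Far⇒nonadjacent {i = i} (inj₁ i≪j) j≡1+i = 1+n≰n (subst (2 + toℕ i ≤_) j≡1+i i≪j)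
Far⇒nonadjacent {i = i} (inj₂ j≪i) j≡1+i =
  1+n≰n (≤-trans (m≤n+m (suc (toℕ i)) 2) (subst (λ k → 2 + k ≤ toℕ i) j≡1+i j≪i))

Spread : List (Fin m) → Set
Spread = AllPairs Far

Spread-resp-↭ : Spread {m} Respects _↭_
Spread-resp-↭ xs↭ys = Permutationₛ.AllPairs-resp-↭ (setoid _) Far-sym (resp₂ Far) (↭⇒↭ₛ xs↭ys)

Spread-shift : ∀ (xs : List (Fin m)) {z ys} → Spread (xs ++ z ∷ ys) → Spread (z ∷ xs ++ ys)
Spread-shift xs {z} {ys} = Spread-resp-↭ (shift z xs ys)

Spread-resp-⊆ : {xs ys : List (Fin m)} → ys ⊆ xs → Spread xs → Spread ys
Spread-resp-⊆ []             []          = []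
Spread-resp-⊆ (_ ∷ʳ ys⊆xs)   (_ ∷ sp)    = Spread-resp-⊆ ys⊆xs sp
Spread-resp-⊆ (refl ∷ ys⊆xs) (x◃xs ∷ sp) = Sublist.All-resp-⊆ ys⊆xs x◃xs ∷ Spread-resp-⊆ ys⊆xs sp

Spread-∈ : {xs : List (Fin m)} → Spread xs → ∀ {i j} → i ∈ₗ xs → j ∈ₗ xs → i ≢ j → Far i j
Spread-∈ (_ ∷ _)     (here refl) (here refl) i≢j = contradiction refl i≢j
Spread-∈ (i◃xs ∷ _)  (here refl) (there j∈)  _   = All.lookup i◃xs j∈
Spread-∈ (j◃xs ∷ _)  (there i∈)  (here refl) _   = Far-sym (All.lookup j◃xs i∈)
Spread-∈ (_ ∷ sp)    (there i∈)  (there j∈)  i≢j = Spread-∈ sp i∈ j∈ i≢j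

⟦_⟧ : List (Fin m) → Subset m
⟦_⟧ = foldr (λ i I → ⁅ i ⁆ ∪ I) ⊥

∈⟦⟧⁺ : {i : Fin m} {xs : List (Fin m)} → i ∈ₗ xs → i ∈ ⟦ xs ⟧
∈⟦⟧⁺ (here refl) = x∈p∪q⁺ (inj₁ (x∈⁅x⁆ _))
∈⟦⟧⁺ (there i∈)  = x∈p∪q⁺ (inj₂ (∈⟦⟧⁺ i∈))

∈⟦⟧⁻ : {i : Fin m} (xs : List (Fin m)) → i ∈ ⟦ xs ⟧ → i ∈ₗ xs
∈⟦⟧⁻ []       i∈ = contradiction i∈ ∉⊥
∈⟦⟧⁻ (x ∷ xs) i∈ with x∈p∪q⁻ ⁅ x ⁆ ⟦ xs ⟧ i∈
... | inj₁ i∈⁅x⁆  = here (x∈⁅y⁆⇒x≡y x i∈⁅x⁆)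
... | inj₂ i∈⟦xs⟧ = there (∈⟦⟧⁻ xs i∈⟦xs⟧)

⟦⟧-nonconsecutive : {xs : List (Fin m)} → Spread xs → Nonconsecutive ⟦ xs ⟧
⟦⟧-nonconsecutive {xs = xs} sp i j i∈ j∈ with i ≟ j
... | yes refl = 1+n≢n ∘ sym
... | no i≢j   = Far⇒nonadjacent (Spread-∈ sp (∈⟦⟧⁻ xs i∈) (∈⟦⟧⁻ xs j∈) i≢j)

∣⁅x⁆∪p∣ : {x : Fin m} {p : Subset m} → x ∉ p → ∣ ⁅ x ⁆ ∪ p ∣ ≡ suc ∣ p ∣
∣⁅x⁆∪p∣ {x = zero}  {false ∷ p} _   = cong (suc ∘ ∣_∣) (∪-identityˡ p)
∣⁅x⁆∪p∣ {x = zero}  {true ∷ p}  x∉p = contradiction here x∉p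
∣⁅x⁆∪p∣ {x = suc x} {false ∷ p} x∉p = ∣⁅x⁆∪p∣ (x∉p ∘ there)
∣⁅x⁆∪p∣ {x = suc x} {true ∷ p}  x∉p = cong suc (∣⁅x⁆∪p∣ (x∉p ∘ there))

∣⟦⟧∣ : {xs : List (Fin m)} → Spread xs → ∣ ⟦ xs ⟧ ∣ ≡ length xs
∣⟦⟧∣ {m} []                    = ∣⊥∣≡0 m
∣⟦⟧∣ {xs = x ∷ xs} (x◃xs ∷ sp) = trans (∣⁅x⁆∪p∣ x∉⟦xs⟧) (cong suc (∣⟦⟧∣ sp))
  where x∉⟦xs⟧ = λ x∈ → Far-irrefl (All.lookup x◃xs (∈⟦⟧⁻ xs x∈))

elements : Subset m → List (Fin m)
elements []          = []
elements (true ∷ p)  = zero ∷ map suc (elements p)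
elements (false ∷ p) = map suc (elements p)

length-elements : (p : Subset m) → length (elements p) ≡ ∣ p ∣
length-elements []          = refl
length-elements (true ∷ p)  = cong suc (trans (length-map suc (elements p)) (length-elements p))
length-elements (false ∷ p) = trans (length-map suc (elements p)) (length-elements p)

elements-∈ : (p : Subset m) → All (_∈ p) (elements p)
elements-∈ []          = []
elements-∈ (true ∷ p)  = here ∷ All.map⁺ (All.map there (elements-∈ p))
elements-∈ (false ∷ p) = All.map⁺ (All.map there (elements-∈ p))

elements-spread : (p : Subset m) → Nonconsecutive p → Spread (elements p)
elements-spread []          _  = []
elements-spread (true ∷ p)  nc = All.map⁺ (All.map far-from-zero (elements-∈ p))
                               ∷ AllPairs.map⁺ (AllPairs.map Far-suc (elements-spread p (Nonconsecutive-tail nc)))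
  where
    far-from-zero : ∀ {j} → j ∈ p → Far zero (suc j)
    far-from-zero {zero}  0∈p = contradiction refl (nc zero (suc zero) here (there 0∈p))
    far-from-zero {suc j} _   = inj₁ (s≤s (s≤s z≤n))
elements-spread (false ∷ p) nc = AllPairs.map⁺ (AllPairs.map Far-suc (elements-spread p (Nonconsecutive-tail nc)))

-- Patterns

matches : (Fin m → Bool) → List (Fin m) → List (Fin m) → Bool
matches s Ys Ns = allB s Ys ∧ allB (not ∘ s) Ns

matches⁺ : {s : Fin m → Bool} {Ys Ns : List (Fin m)} →
           All (λ i → s i ≡ true) Ys → All (λ j → s j ≡ false) Ns → matches s Ys Ns ≡ true
matches⁺ Ys-in Ns-out = cong₂ _∧_ (allB⁺ Ys-in) (allB⁺ (All.map (cong not) Ns-out))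

matches⁻ : (s : Fin m → Bool) (Ys Ns : List (Fin m)) → matches s Ys Ns ≡ true →
           All (λ i → s i ≡ true) Ys × All (λ j → s j ≡ false) Ns
matches⁻ s Ys Ns h with allB s Ys in Ys-in
... | true = allB⁻ s Ys Ys-in , All.map not-injective (allB⁻ (not ∘ s) Ns h)

module _ (A : SetSystem n m) where

  row : Fin n → Fin m → Bool
  row u i = lookup (A i) u

  matchCount : List (Fin m) → List (Fin m) → ℕ
  matchCount Ys Ns = count (λ u → matches (row u) Ys Ns)

  0<matchCount : ∀ Ys Ns {u} → matches (row u) Ys Ns ≡ true → 0 < matchCount Ys Ns
  0<matchCount Ys Ns = 0<count (λ v → matches (row v) Ys Ns)

  matchCount-split : ∀ z Ys Ns → matchCount Ys Ns ≡ matchCount (z ∷ Ys) Ns + matchCount Ys (z ∷ Ns)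
  matchCount-split z Ys Ns = trans (count-split (λ u → row u z) _)
    (cong₂ _+_ (count-cong λ u → sym (∧-assoc (row u z) _ _))
               (count-cong λ u → ∧-swap (allB (row u) Ys) (not (row u z)) _))
    where
      ∧-swap : ∀ x y z → y ∧ (x ∧ z) ≡ x ∧ (y ∧ z)
      ∧-swap x y z = trans (sym (∧-assoc y x z)) (trans (cong (_∧ z) (∧-comm y x)) (∧-assoc x y z))

  H-⟦⟧ : ∀ Ys u → lookup (H_ A ⟦ Ys ⟧) u ≡ allB (row u) Ys
  H-⟦⟧ Ys u = ⇔→≡ (mk⇔ to from)
    where
      to : lookup (H_ A ⟦ Ys ⟧) u ≡ true → allB (row u) Ys ≡ true
      to u∈H = allB⁺ {xs = Ys} (All.tabulate λ i∈Ys →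
        []=⇒lookup (Equivalence.to (∈H⇔ A ⟦ Ys ⟧) (lookup⇒[]= u _ u∈H) (∈⟦⟧⁺ {xs = Ys} i∈Ys)))
      from : allB (row u) Ys ≡ true → lookup (H_ A ⟦ Ys ⟧) u ≡ true
      from u∈A[Ys] = []=⇒lookup (Equivalence.from (∈H⇔ A ⟦ Ys ⟧) λ {i} i∈⟦Ys⟧ →
        lookup⇒[]= u (A i) (All.lookup (allB⁻ (row u) Ys u∈A[Ys]) (∈⟦⟧⁻ Ys i∈⟦Ys⟧)))

  matchCount-H : ∀ Ys → matchCount Ys [] ≡ ∣ H_ A ⟦ Ys ⟧ ∣
  matchCount-H Ys = count-cong λ u → trans (∧-identityʳ _) (trans (sym (H-⟦⟧ Ys u)) (lookup∘tabulate _ u))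

  harmonic-matchCount : Harmonic A → ∀ Ys Ns Ys′ Ns′ → Spread (Ys ++ Ns) → Spread (Ys′ ++ Ns′) →
                        length Ys ≡ length Ys′ → length Ns ≡ length Ns′ → matchCount Ys Ns ≡ matchCount Ys′ Ns′
  harmonic-matchCount harmonic Ys [] Ys′ [] sp sp′ ∣Ys∣≡ _ = begin
    matchCount Ys []    ≡⟨ matchCount-H Ys ⟩
    ∣ H_ A ⟦ Ys ⟧ ∣     ≡⟨ harmonic-nonconsecutive A harmonic (⟦⟧-nonconsecutive spY) (⟦⟧-nonconsecutive spY′)
                             (trans (∣⟦⟧∣ spY) (trans ∣Ys∣≡ (sym (∣⟦⟧∣ spY′)))) ⟩
    ∣ H_ A ⟦ Ys′ ⟧ ∣    ≡⟨ matchCount-H Ys′ ⟨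
    matchCount Ys′ []   ∎
    where
      open ≡-Reasoning
      spY  = subst Spread (++-identityʳ Ys) sp
      spY′ = subst Spread (++-identityʳ Ys′) sp′
  harmonic-matchCount harmonic Ys (z ∷ Ns) Ys′ (z′ ∷ Ns′) sp sp′ ∣Ys∣≡ ∣zNs∣≡ = +-cancelˡ-≡ _ _ _ (begin
    matchCount (z ∷ Ys) Ns + matchCount Ys (z ∷ Ns)        ≡⟨ matchCount-split z Ys Ns ⟨
    matchCount Ys Ns                                       ≡⟨ without-z ⟩
    matchCount Ys′ Ns′                                     ≡⟨ matchCount-split z′ Ys′ Ns′ ⟩
    matchCount (z′ ∷ Ys′) Ns′ + matchCount Ys′ (z′ ∷ Ns′)  ≡⟨ cong (_+ _) z-positive ⟨
    matchCount (z ∷ Ys) Ns + matchCount Ys′ (z′ ∷ Ns′)     ∎)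
    where
      open ≡-Reasoning
      ∣Ns∣≡ = suc-injective ∣zNs∣≡
      drop-middle : ∀ Zs {z Ms} → Spread (Zs ++ z ∷ Ms) → Spread (Zs ++ Ms)
      drop-middle Zs sp with _ ∷ sp′ ← Spread-shift Zs sp = sp′
      without-z = harmonic-matchCount harmonic Ys Ns Ys′ Ns′ (drop-middle Ys sp) (drop-middle Ys′ sp′) ∣Ys∣≡ ∣Ns∣≡
      z-positive = harmonic-matchCount harmonic (z ∷ Ys) Ns (z′ ∷ Ys′) Ns′
                     (Spread-shift Ys sp) (Spread-shift Ys′ sp′) (cong suc ∣Ys∣≡) ∣Ns∣≡

trues falses : (Fin m → Bool) → List (Fin m) → List (Fin m)
trues  s = filter (λ i → s i Bool.≟ true)
falses s = filter (λ i → s i Bool.≟ false)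

trues++falses↭ : (s : Fin m → Bool) (xs : List (Fin m)) → trues s xs ++ falses s xs ↭ xs
trues++falses↭ s []       = ↭-refl
trues++falses↭ s (x ∷ xs) with s x
... | true  = prep x (trues++falses↭ s xs)
... | false = ↭-trans (shift x (trues s xs) (falses s xs)) (prep x (trues++falses↭ s xs))

length-trues-falses : (s : Fin m → Bool) (xs : List (Fin m)) → length (trues s xs) + length (falses s xs) ≡ length xs
length-trues-falses s xs = trans (sym (length-++ (trues s xs))) (↭-length (trues++falses↭ s xs))

length-≤-filter : ∀ {X : Set} {P : X → Set} (P? : U.Decidable P) {xs ys : List X} →
                  All P ys → ys ⊆ xs → length ys ≤ length (filter P? xs)
length-≤-filter P? all-P ys⊆xs = Sublist.length-mono-≤
  (subst (_⊆ _) (filter-all P? all-P) (Sublist.filter⁺ P? P? (λ { refl → id }) ys⊆xs))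

length-take-≤ : ∀ {X : Set} {k} {xs : List X} → k ≤ length xs → length (take k xs) ≡ k
length-take-≤ {k = k} {xs} k≤∣xs∣ = trans (length-take k xs) (m≤n⇒m⊓n≡m k≤∣xs∣)

-- Binomial lower bound

-- binom k l is the binomial coefficient C(k + l, k); in this symmetric form Pascal's rule is
-- the defining recursion.
binom : ℕ → ℕ → ℕ
binom zero    l       = 1
binom (suc k) zero    = 1
binom (suc k) (suc l) = binom k (suc l) + binom (suc k) l

binom-zeroʳ : ∀ k → binom k 0 ≡ 1
binom-zeroʳ zero    = refl
binom-zeroʳ (suc k) = refl

binom-pascal-≤ : ∀ k l {x y} → 0 < k + l →
                 (∀ {k′} → k ≡ suc k′ → binom k′ l ≤ x) → (∀ {l′} → l ≡ suc l′ → binom k l′ ≤ y) →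
                 binom k l ≤ x + y
binom-pascal-≤ zero    (suc l) _ _   ≤y = ≤-trans (≤y refl) (m≤n+m _ _)
binom-pascal-≤ (suc k) zero    _ ≤x _  = ≤-trans (≤-reflexive (sym (binom-zeroʳ k))) (≤-trans (≤x refl) (m≤m+n _ _))
binom-pascal-≤ (suc k) (suc l) _ ≤x ≤y = +-mono-≤ (≤x refl) (≤y refl)

module _ (A : SetSystem n m) {a b : ℕ}
         (matched : ∀ Ys Ns → Spread (Ys ++ Ns) → length Ys ≡ a → length Ns ≡ b → 0 < matchCount A Ys Ns)
         where

  binom-≤-matchCount : ∀ k l Ds Ys Ns → Spread (Ys ++ Ds ++ Ns) → length Ds ≡ k + l →
                       length Ys + k ≡ a → length Ns + l ≡ b → binom k l ≤ matchCount A Ys Ns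
  binom-≤-matchCount zero zero [] Ys Ns sp _ ∣Ys∣≡ ∣Ns∣≡ =
    matched Ys Ns sp (trans (sym (+-identityʳ _)) ∣Ys∣≡) (trans (sym (+-identityʳ _)) ∣Ns∣≡)
  binom-≤-matchCount k l (d ∷ Ds) Ys Ns sp ∣dDs∣≡ ∣Ys∣≡ ∣Ns∣≡ =
    subst (binom k l ≤_) (sym (matchCount-split A d Ys Ns))
          (binom-pascal-≤ k l (subst (0 <_) ∣dDs∣≡ (s≤s z≤n)) d-positive d-negative)
    where
      d-positive : ∀ {k′} → k ≡ suc k′ → binom k′ l ≤ matchCount A (d ∷ Ys) Ns
      d-positive {k′} refl = binom-≤-matchCount k′ l Ds (d ∷ Ys) Ns (Spread-shift Ys sp)
        (suc-injective ∣dDs∣≡) (trans (sym (+-suc _ _)) ∣Ys∣≡) ∣Ns∣≡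
      d-negative : ∀ {l′} → l ≡ suc l′ → binom k l′ ≤ matchCount A Ys (d ∷ Ns)
      d-negative {l′} refl = binom-≤-matchCount k l′ Ds Ys (d ∷ Ns)
        (Spread-resp-↭ (++⁺ˡ Ys (↭-sym (shift d Ds Ns))) sp)
        (suc-injective (trans ∣dDs∣≡ (+-suc k l′))) ∣Ys∣≡ (trans (sym (+-suc _ _)) ∣Ns∣≡)

module _ (A : SetSystem n m) (harmonic : Harmonic A) where

  binom-trues-falses≤n : {D : List (Fin m)} → Spread D → (u : Fin n) →
                         binom (length (trues (row A u) D)) (length (falses (row A u) D)) ≤ n
  binom-trues-falses≤n {D} spD u = ≤-trans
    (binom-≤-matchCount A matched a b D [] [] (subst Spread (sym (++-identityʳ D)) spD)
                        (sym (length-trues-falses r D)) refl refl)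
    (count≤n _)
    where
      r = row A u
      a = length (trues r D)
      b = length (falses r D)
      sp-row : Spread (trues r D ++ falses r D)
      sp-row = Spread-resp-↭ (↭-sym (trues++falses↭ r D)) spD
      matched : ∀ Ys Ns → Spread (Ys ++ Ns) → length Ys ≡ a → length Ns ≡ b → 0 < matchCount A Ys Ns
      matched Ys Ns sp ∣Ys∣≡a ∣Ns∣≡b = subst (0 <_)
        (harmonic-matchCount A harmonic (trues r D) (falses r D) Ys Ns sp-row sp (sym ∣Ys∣≡a) (sym ∣Ns∣≡b))
        (0<matchCount A (trues r D) (falses r D) (matches⁺ (All.all-filter _ D) (All.all-filter _ D)))

  many-trues-and-falses : ∀ {a b D} → Spread D → a + b ≤ length D →
    ∀ Ys Ns → Spread (Ys ++ Ns) → length Ys ≡ a → length Ns ≡ b → 0 < matchCount A Ys Ns →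
    ∃ λ u → a ≤ length (trues (row A u) D) × b ≤ length (falses (row A u) D)
  many-trues-and-falses {a} {b} {D} spD a+b≤∣D∣ Ys Ns sp ∣Ys∣≡a ∣Ns∣≡b 0<cnt =
    u , ≤-trans (≤-reflexive (sym ∣Y*∣≡a)) (length-≤-filter _ Y*-in (Sublist.take-⊆ a D))
      , ≤-trans (≤-reflexive (sym ∣N*∣≡b)) (length-≤-filter _ N*-out (⊆-trans (Sublist.take-⊆ b _) (Sublist.drop-⊆ a D)))
    where
      Y* = take a D
      N* = take b (drop a D)
      ∣Y*∣≡a : length Y* ≡ a
      ∣Y*∣≡a = length-take-≤ (m+n≤o⇒m≤o a a+b≤∣D∣)
      ∣N*∣≡b : length N* ≡ b
      ∣N*∣≡b = length-take-≤ (subst (b ≤_) (sym (length-drop a D))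
                 (subst (_≤ length D ∸ a) (m+n∸m≡n a b) (∸-monoˡ-≤ a a+b≤∣D∣)))
      sp* : Spread (Y* ++ N*)
      sp* = Spread-resp-⊆ (subst (Y* ++ N* ⊆_) (take++drop≡id a D) (Sublist.++⁺ ⊆-refl (Sublist.take-⊆ b _))) spD
      u-matches = 0<count⇒∃ _ (subst (0 <_)
        (harmonic-matchCount A harmonic Ys Ns Y* N* sp sp* (trans ∣Ys∣≡a (sym ∣Y*∣≡a)) (trans ∣Ns∣≡b (sym ∣N*∣≡b)))
        0<cnt)
      u = proj₁ u-matches
      Y*-in  = proj₁ (matches⁻ (row A u) Y* N* (proj₂ u-matches))
      N*-out = proj₂ (matches⁻ (row A u) Y* N* (proj₂ u-matches))

-- Trading interleaved positions for far ones

Gapped : List (Fin m) → Set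
Gapped = AllPairs (λ i j → 2 + toℕ i ≤ toℕ j)

Gapped⇒Spread : {xs : List (Fin m)} → Gapped xs → Spread xs
Gapped⇒Spread = AllPairs.map inj₁

evens : ∀ m → List (Fin m)
evens zero          = []
evens (suc zero)    = zero ∷ []
evens (suc (suc m)) = zero ∷ map (Fin.suc ∘ Fin.suc) (evens m)

evens-gapped : ∀ m → Gapped (evens m)
evens-gapped zero          = []
evens-gapped (suc zero)    = [] ∷ []
evens-gapped (suc (suc m)) = All.map⁺ {f = Fin.suc ∘ Fin.suc} (All.universal (λ _ → s≤s (s≤s z≤n)) (evens m))
                           ∷ AllPairs.map⁺ {f = Fin.suc ∘ Fin.suc} (AllPairs.map (s≤s ∘ s≤s) (evens-gapped m))

length-evens : ∀ m → m ≤ 2 * length (evens m)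
length-evens zero          = z≤n
length-evens (suc zero)    = s≤s z≤n
length-evens (suc (suc m)) = begin
  2 + m                        ≤⟨ +-monoʳ-≤ 2 (length-evens m) ⟩
  2 + 2 * length (evens m)     ≡⟨ *-suc 2 (length (evens m)) ⟨
  2 * suc (length (evens m))   ≡⟨ cong (λ k → 2 * suc k) (length-map _ (evens m)) ⟨
  2 * length (evens (2 + m))   ∎
  where open ≤-Reasoning

-- If c is the first entry within distance 1 of b, every later entry exceeds b and every entry
-- after the next one exceeds b + 2.
length-filter-Far : ∀ (b : Fin m) {L} → Gapped L → length L ≤ 2 + length (filter (λ c → Far? c b) L)
length-filter-Far b []                 = z≤n
length-filter-Far b {c ∷ L} (c◃L ∷ gL) with Far? c b
... | yes c-far  = subst (λ F → suc (length L) ≤ 2 + length F) (sym (filter-accept (λ c → Far? c b) c-far))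
                     (s≤s (length-filter-Far b gL))
... | no c-near = subst (λ F → suc (length L) ≤ 2 + length F) (sym (filter-reject (λ c → Far? c b) c-near))
                     (s≤s (past-c L c◃L gL))
  where
    b≤1+c : toℕ b ≤ suc (toℕ c)
    b≤1+c = ≤-pred (≰⇒> (c-near ∘ inj₁))
    past-c : ∀ L → All (λ d → 2 + toℕ c ≤ toℕ d) L → Gapped L → length L ≤ 1 + length (filter (λ c → Far? c b) L)
    past-c []      _         _         = z≤n
    past-c (d ∷ L) (c≪d ∷ _) (d◃L ∷ _) = s≤s (≤-trans (≤-reflexive all-kept)
      (length-≤-filter (λ c → Far? c b) (All.all-filter _ L) (d ∷ʳ Sublist.filter-⊆ _ L)))
      where
        all-kept : length L ≡ length (filter (λ c → Far? c b) L)
        all-kept = cong length (sym (filter-all (λ c → Far? c b)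
          (All.map (λ d≪e → inj₂ (≤-trans (s≤s (s≤s b≤1+c)) (≤-trans (s≤s c≪d) (≤-trans (n≤1+n _) d≪e)))) d◃L)))

remove-near : ∀ (bs : List (Fin m)) {D : List (Fin m)} → Gapped D →
              ∃ λ F → Gapped F × All (λ c → All (Far c) bs) F × length D ≤ 2 * length bs + length F
remove-near []       {D} gD = D , gD , All.universal (λ _ → []) D , ≤-refl
remove-near (b ∷ bs)     gD with F , gF , F-far , ∣D∣≤ ← remove-near bs gD =
  filter (λ c → Far? c b) F ,
  AllPairs.filter⁺ _ gF ,
  All.zipWith (λ (c-far-b , c-far-bs) → c-far-b ∷ c-far-bs) (All.all-filter _ F , All.filter⁺ _ F-far) ,
  ≤-trans ∣D∣≤ (≤-trans (+-monoʳ-≤ (2 * length bs) (length-filter-Far b gF)) (≤-reflexive (regroup (length bs) _)))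
  where
    regroup : ∀ k x → 2 * k + (2 + x) ≡ 2 * suc k + x
    regroup = solve-∀

-- Among the entries of D far from xs ++ ys there are at least |xs| + |ys|, so either |xs| of
-- them lie in s, and replace xs, or |ys| of them lie outside s, and replace ys.
spread-matching-pattern :
  (s : Fin m → Bool) {D xs ys : List (Fin m)} → Gapped D → 3 * (length xs + length ys) ≤ length D →
  Spread xs → Spread ys → All (λ i → s i ≡ true) xs → All (λ j → s j ≡ false) ys →
  ∃₂ λ Ys Ns → Spread (Ys ++ Ns) × length Ys ≡ length xs × length Ns ≡ length ys × matches s Ys Ns ≡ true
spread-matching-pattern s {D} {xs} {ys} gD ∣D∣≥ sp-xs sp-ys xs-in ys-out
  with F , gF , F-far , ∣D∣≤ ← remove-near (xs ++ ys) gD = pick (length xs ≤? length (trues s F))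
  where
    sp-F = Gapped⇒Spread gF

    ∣F∣≥ : length xs + length ys ≤ length F
    ∣F∣≥ = +-cancelˡ-≤ (2 * t) _ _ (begin
      2 * t + t                          ≡⟨ +-comm (2 * t) t ⟩
      3 * t                              ≤⟨ ∣D∣≥ ⟩
      length D                           ≤⟨ ∣D∣≤ ⟩
      2 * length (xs ++ ys) + length F   ≡⟨ cong (λ k → 2 * k + length F) (length-++ xs) ⟩
      2 * t + length F                   ∎)
      where
        open ≤-Reasoning
        t = length xs + length ys

    pick : Dec (length xs ≤ length (trues s F)) →
           ∃₂ λ Ys Ns → Spread (Ys ++ Ns) × length Ys ≡ length xs × length Ns ≡ length ys × matches s Ys Ns ≡ true
    pick (yes ∣xs∣≤) = Ys , ys , AllPairs.++⁺ sp-Ys sp-ys Ys-far , length-take-≤ ∣xs∣≤ , refl ,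
                       matches⁺ {Ys = Ys} (All.take⁺ _ (All.all-filter _ F)) ys-out
      where
        Ys = take (length xs) (trues s F)
        sp-Ys = AllPairs.take⁺ _ (AllPairs.filter⁺ _ sp-F)
        Ys-far = All.take⁺ _ (All.filter⁺ _ (All.map (All.++⁻ʳ xs) F-far))
    pick (no ∣xs∣≰) = xs , Ns , AllPairs.++⁺ sp-xs sp-Ns xs-far , refl , length-take-≤ ∣ys∣≤ ,
                      matches⁺ {Ns = Ns} xs-in (All.take⁺ _ (All.all-filter _ F))
      where
        Ns = take (length ys) (falses s F)
        sp-Ns = AllPairs.take⁺ _ (AllPairs.filter⁺ _ sp-F)
        xs-far = All.All-swap (All.take⁺ _ (All.filter⁺ _ (All.map (All.map Far-sym ∘ All.++⁻ˡ xs) F-far)))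
        ∣ys∣≤ : length ys ≤ length (falses s F)
        ∣ys∣≤ = +-cancelˡ-≤ (length xs) _ _ (begin
          length xs + length ys                      ≤⟨ ∣F∣≥ ⟩
          length F                                   ≡⟨ length-trues-falses s F ⟨
          length (trues s F) + length (falses s F)   ≤⟨ +-monoˡ-≤ _ (<⇒≤ (≰⇒> ∣xs∣≰)) ⟩
          length xs + length (falses s F)            ∎)
          where open ≤-Reasoning

binom-sym : ∀ k l → binom k l ≡ binom l k
binom-sym zero    zero    = refl
binom-sym zero    (suc l) = refl
binom-sym (suc k) zero    = refl
binom-sym (suc k) (suc l) =
  trans (cong₂ _+_ (binom-sym k (suc l)) (binom-sym (suc k) l)) (+-comm (binom (suc l) k) _)

binom-one : ∀ l → binom 1 l ≡ 1 + l
binom-one zero    = refl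
binom-one (suc l) = cong suc (binom-one l)

binom-two : ∀ l → 2 * binom 2 l ≡ (2 + l) * (1 + l)
binom-two zero    = refl
binom-two (suc l) = begin
  2 * (binom 1 (suc l) + binom 2 l)     ≡⟨ *-distribˡ-+ 2 (binom 1 (suc l)) (binom 2 l) ⟩
  2 * binom 1 (suc l) + 2 * binom 2 l   ≡⟨ cong₂ (λ x y → 2 * x + y) (binom-one (suc l)) (binom-two l) ⟩
  2 * (2 + l) + (2 + l) * (1 + l)       ≡⟨ factor l ⟩
  (3 + l) * (2 + l)                     ∎
  where
    open ≡-Reasoning
    factor : ∀ l → 2 * (2 + l) + (2 + l) * (1 + l) ≡ (3 + l) * (2 + l)
    factor = solve-∀

binom-three : ∀ l → 6 * binom 3 l ≡ (3 + l) * (2 + l) * (1 + l)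
binom-three zero    = refl
binom-three (suc l) = begin
  6 * (binom 2 (suc l) + binom 3 l)                       ≡⟨ *-distribˡ-+ 6 (binom 2 (suc l)) (binom 3 l) ⟩
  6 * binom 2 (suc l) + 6 * binom 3 l                     ≡⟨ cong (_+ 6 * binom 3 l) (*-assoc 3 2 (binom 2 (suc l))) ⟩
  3 * (2 * binom 2 (suc l)) + 6 * binom 3 l               ≡⟨ cong₂ (λ x y → 3 * x + y) (binom-two (suc l)) (binom-three l) ⟩
  3 * ((3 + l) * (2 + l)) + (3 + l) * (2 + l) * (1 + l)   ≡⟨ factor l ⟩
  (4 + l) * (3 + l) * (2 + l)                             ∎
  where
    open ≡-Reasoning
    factor : ∀ l → 3 * ((3 + l) * (2 + l)) + (3 + l) * (2 + l) * (1 + l) ≡ (4 + l) * (3 + l) * (2 + l)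
    factor = solve-∀

cubic : ℕ → ℕ
cubic s = (6 + s) * (5 + s) * (4 + s)

cubic-≤-binom : ∀ k l → cubic (k + l) ≤ 6 * binom (3 + k) (3 + l)
cubic-≤-binom zero    l       = ≤-reflexive (sym (binom-three (3 + l)))
cubic-≤-binom (suc k) zero    = ≤-reflexive (begin
  cubic (suc k + 0)         ≡⟨ cong cubic (+-identityʳ (suc k)) ⟩
  cubic (suc k)             ≡⟨ binom-three (3 + suc k) ⟨
  6 * binom 3 (3 + suc k)   ≡⟨ cong (6 *_) (binom-sym 3 (3 + suc k)) ⟩
  6 * binom (3 + suc k) 3   ∎)
  where open ≡-Reasoning
cubic-≤-binom (suc k) (suc l) = begin
  cubic (suc k + suc l)                      ≡⟨ cong (cubic ∘ suc) (+-suc k l) ⟩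
  cubic (2 + (k + l))                        ≤⟨ cubic-step (k + l) ⟩
  cubic (1 + (k + l)) + cubic (1 + (k + l))  ≡⟨ cong (λ s → cubic s + cubic (suc k + l)) (+-suc k l) ⟨
  cubic (k + suc l) + cubic (suc k + l)      ≤⟨ +-mono-≤ (cubic-≤-binom k (suc l)) (cubic-≤-binom (suc k) l) ⟩
  6 * binom (3 + k) (3 + suc l) + 6 * binom (3 + suc k) (3 + l)
    ≡⟨ *-distribˡ-+ 6 (binom (3 + k) (3 + suc l)) (binom (3 + suc k) (3 + l)) ⟨
  6 * binom (3 + suc k) (3 + suc l)          ∎
  where
    open ≤-Reasoning
    cubic-step : ∀ s → cubic (2 + s) ≤ cubic (1 + s) + cubic (1 + s)
    cubic-step s = subst₂ _≤_ (sym (lhs s)) (sym (rhs s)) (*-monoˡ-≤ ((7 + s) * (6 + s)) (m≤m+n (8 + s) (2 + s)))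
      where
        lhs : ∀ s → (8 + s) * (7 + s) * (6 + s) ≡ (8 + s) * ((7 + s) * (6 + s))
        lhs = solve-∀
        rhs : ∀ s → (7 + s) * (6 + s) * (5 + s) + (7 + s) * (6 + s) * (5 + s) ≡ ((8 + s) + (2 + s)) * ((7 + s) * (6 + s))
        rhs = solve-∀

m*[m∸2]≤binom : ∀ {m a b} → 51 ≤ m → m ≤ 2 * (a + b) → 3 ≤ a → 3 ≤ b → m * (m ∸ 2) ≤ binom a b
m*[m∸2]≤binom {m} {3+k@(suc (suc (suc k)))} {3+l@(suc (suc (suc l)))} 51≤m m≤2[a+b] (s≤s (s≤s (s≤s _))) (s≤s (s≤s (s≤s _))) =
  *-cancelˡ-≤ 6 (begin
    6 * (m * (m ∸ 2))                   ≤⟨ *-monoʳ-≤ 6 (*-mono-≤ m≤12+2s (∸-monoˡ-≤ 2 m≤12+2s)) ⟩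
    6 * ((12 + 2 * s) * (10 + 2 * s))   ≡⟨ regroup s ⟩
    24 * ((6 + s) * (5 + s))            ≤⟨ *-monoˡ-≤ ((6 + s) * (5 + s)) (+-monoʳ-≤ 4 20≤s) ⟩
    (4 + s) * ((6 + s) * (5 + s))       ≡⟨ reorder s ⟩
    cubic s                             ≤⟨ cubic-≤-binom k l ⟩
    6 * binom 3+k 3+l                   ∎)
  where
    open ≤-Reasoning
    s = k + l
    m≤12+2s : m ≤ 12 + 2 * s
    m≤12+2s = ≤-trans m≤2[a+b] (≤-reflexive (expand k l))
      where
        expand : ∀ k l → 2 * ((3 + k) + (3 + l)) ≡ 12 + 2 * (k + l)
        expand = solve-∀
    20≤s : 20 ≤ s
    20≤s = *-cancelˡ-< 2 19 s (+-cancelˡ-≤ 12 _ _ (≤-trans 51≤m m≤12+2s))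
    regroup : ∀ s → 6 * ((12 + 2 * s) * (10 + 2 * s)) ≡ 24 * ((6 + s) * (5 + s))
    regroup = solve-∀
    reorder : ∀ s → (4 + s) * ((6 + s) * (5 + s)) ≡ (6 + s) * (5 + s) * (4 + s)
    reorder = solve-∀

proposition4p24 : (n m : ℕ) → (A : SetSystem n m) → Harmonic A → n < m * (m ∸ 2) → m ≥ 51 → (I J : Subset m) → Nonconsecutive I → Nonconsecutive J → ∣ I ∣ ≡ 3 → ∣ J ∣ ≡ 3 → (u : Fin n) → ¬ ((∀ i → i ∈ I → u ∈ A i) × (∀ j → j ∈ J → u ∉ A j))
proposition4p24 n m A harmonic n<m[m∸2] 51≤m I J ncI ncJ ∣I∣≡3 ∣J∣≡3 u (u∈A[I] , u∉A[J]) =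
  let Ys , Ns , sp , ∣Ys∣≡ , ∣Ns∣≡ , u-matches =
        spread-matching-pattern (row A u) gD (subst (_≤ length D) (sym 3[∣xs∣+∣ys∣]≡18) 18≤∣D∣)
                                (elements-spread I ncI) (elements-spread J ncJ) xs-in ys-out
      u₁ , 3≤a , 3≤b = many-trues-and-falses A harmonic (Gapped⇒Spread gD) (≤-trans (m≤m+n 6 12) 18≤∣D∣)
                         Ys Ns sp (trans ∣Ys∣≡ ∣xs∣≡3) (trans ∣Ns∣≡ ∣ys∣≡3) (0<matchCount A Ys Ns u-matches)
      m≤2[a+b] = ≤-trans (length-evens m) (≤-reflexive (cong (2 *_) (sym (length-trues-falses (row A u₁) D))))
  in <-irrefl refl (<-≤-trans n<m[m∸2] (≤-trans (m*[m∸2]≤binom 51≤m m≤2[a+b] 3≤a 3≤b)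
                                                 (binom-trues-falses≤n A harmonic (Gapped⇒Spread gD) u₁)))
  where
    D  = evens m
    gD = evens-gapped m
    xs = elements I
    ys = elements J
    ∣xs∣≡3 = trans (length-elements I) ∣I∣≡3
    ∣ys∣≡3 = trans (length-elements J) ∣J∣≡3
    3[∣xs∣+∣ys∣]≡18 : 3 * (length xs + length ys) ≡ 18
    3[∣xs∣+∣ys∣]≡18 = cong (3 *_) (cong₂ _+_ ∣xs∣≡3 ∣ys∣≡3)
    18≤∣D∣ : 18 ≤ length D
    18≤∣D∣ = *-cancelˡ-≤ 2 (≤-trans (m≤m+n 36 15) (≤-trans 51≤m (length-evens m)))
    xs-in : All (λ i → row A u i ≡ true) xs
    xs-in = All.map (λ i∈I → []=⇒lookup (u∈A[I] _ i∈I)) (elements-∈ I)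
    ys-out : All (λ j → row A u j ≡ false) ys
    ys-out = All.map (λ j∈J → ¬-not (u∉A[J] _ j∈J ∘ lookup⇒[]= u _)) (elements-∈ J)
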